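{- The principle $\mathsf{NCR}$ holds in the topos $\mathcal{N}$: for all types $S,T$ and every formula $\Phi(x,y)$ of $\mathcal{L}_{\mathrm{st}}$ with $x:S$, $y:T$ (possibly with further free variables), every universally closed instance of $\forall y: T\, \exists^{\mathrm{st}} x: S \, \Phi(x,y) \to \exists^{\mathrm{st}} s: S^* \, \forall y: T\, \exists x \in s \, \Phi(x,y)$ is valid in $\mathcal{N}$.
   Context: Let $\mathfrak{F}\mathbf{Set}$ be the category whose objects are pairs $(C,(\mathcal{F}_i)_{i\in I})$ with $C$ a set and $(\mathcal{F}_i)_{i\in I}$ an inhabited family of subsets of $C$ (base sets) such that for all $i,j$ there is $k$ with $\mathcal{F}_k\subseteq\mathcal{F}_i\cap\mathcal{F}_j$. A morphism $(C,\mathcal{F}_I)\to(D,\mathcal{G}_J)$ is an equivalence class of functions $\alpha:\mathcal{F}_i\to D$ defined on some base set, such that for all $j\in J$ there is $i'$ with $\mathcal{F}_{i'}\subseteq\alpha^{ -1}(\mathcal{G}_j)$; two such are equivalent if they agree on some base set contained in both domains. A set $S$ is identified with $(S,\{S\})$. $K$ is the Grothendieck topology in which a finite family $\{\beta_k:\mathcal{G}_k\to\mathcal{F}\}_{k=1}^n$ is covering iff for every choice of base sets $\mathcal{G}_{k,j_k}$ there is a base set $\mathcal{F}_i\subseteq\bigcup_k\beta_k(\mathcal{G}_{k,j_k})$. $\mathcal{N}:=\mathrm{Sh}(\mathfrak{F}\mathbf{Set},K)$. $\Delta S$ is the sheaf with $(\Delta S)\mathcal{F}$ = morphisms $\mathcal{F}\to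 S$ taking finitely many values. $\mathcal{L}$ is a many-sorted first-order language with a fixed interpretation in $\mathbf{Set}$, types closed under $S\mapsto S^*$ (finite sequences); $\mathcal{L}_{\mathrm{st}}$ adds predicates $\mathrm{st}_S$. Interpretation in $\mathcal{N}$: $S\mapsto\mathbf{y}S$, symbols via Yoneda, $\mathrm{st}_S\mapsto\Delta S$. $\forall^{\mathrm{st}},\exists^{\mathrm{st}}$ are relativisations to $\mathrm{st}$; $x\in s$ means $x$ is a component of $s$. A schema holds in $\mathcal{N}$ if all its universally closed instances are valid in the internal logic. -}

module Defs where

open import Level using (Lift; lift)
open import Data.Product using (Σ; Σ-syntax; _×_; _,_; proj₁; proj₂)
open import Data.Sum using (_⊎_)
open import Data.Unit using (⊤; tt)
open import Data.Empty using (⊥)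
open import Data.Nat using (ℕ)
open import Data.Fin using (Fin)
open import Data.List using (List; []; _∷_)
open import Data.List.Relation.Unary.All as All using (All; []; _∷_)
open import Data.List.Relation.Unary.Any using (here; there)
open import Data.List.Membership.Propositional using (_∈_)
open import Relation.Binary.PropositionalEquality using (_≡_; refl)

-- An object (C, (F_i)_{i∈I}): a set C with an inhabited, downward
-- directed family of subsets (base sets).  Subsets are propositional
-- predicates on C.
record FSet : Set₁ where
  field
    Car       : Set
    Idx       : Set
    Base      : Idx → Car → Set
    Base-prop : ∀ i c (p q : Base i c) → p ≡ q
    inhabited : Idx
    directed  : ∀ i j → Σ[ k ∈ Idx ] (∀ c → Base k c → Base i c × Base j c)
open FSet public

Sub : (F : FSet) → Idx F → Idx F → Set
Sub F i j = ∀ c → Base F i c → Base F j c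

-- A representative of a morphism F → G: a function α : F_i → D defined on
-- a base set, such that every α⁻¹(G_j) contains a base set.
record Mor (F G : FSet) : Set where
  field
    dom  : Idx F
    fun  : (c : Car F) → Base F dom c → Car G
    cont : ∀ j → Σ[ i ∈ Idx F ] (∀ c → (p : Base F i c) →
                   Σ[ q ∈ Base F dom c ] Base G j (fun c q))
open Mor public

-- Two representatives are equivalent iff they agree on a common base set.
-- (Morphisms are the equivalence classes; all notions below respect ≈M.)
_≈M_ : {F G : FSet} → Mor F G → Mor F G → Set
_≈M_ {F} α β = Σ[ k ∈ Idx F ] Σ[ hα ∈ Sub F k (dom α) ] Σ[ hβ ∈ Sub F k (dom β) ]
                 (∀ c (p : Base F k c) → fun α c (hα c p) ≡ fun β c (hβ c p))

setF : Set → FSet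
setF S = record
  { Car = S ; Idx = ⊤ ; Base = λ _ _ → ⊤ ; Base-prop = λ _ _ _ _ → refl
  ; inhabited = tt ; directed = λ _ _ → tt , λ _ _ → tt , tt }

-- Generalised elements of the representable sheaf  y S  at stage F.
Elt : FSet → Set → Set
Elt F S = Mor F (setF S)

restrict : {G F : FSet} {S : Set} → Mor G F → Elt F S → Elt G S
restrict {G} β a = record
  { dom  = proj₁ (cont β (dom a))
  ; fun  = λ c p → fun a (fun β c (proj₁ (proj₂ (cont β (dom a)) c p)))
                         (proj₂ (proj₂ (cont β (dom a)) c p))
  ; cont = λ _ → proj₁ (cont β (dom a)) , λ c p → p , tt }

extend : {F : FSet} {A : Set} {P : A → Set} {xs : List A} {x : A} →
         Elt F (All P xs) → Elt F (P x) → Elt F (All P (x ∷ xs))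
extend {F} ρ b = record
  { dom  = k
  ; fun  = λ c p → fun b c (proj₂ (h c p)) ∷ fun ρ c (proj₁ (h c p))
  ; cont = λ _ → k , λ c p → p , tt }
  where
    k = proj₁ (directed F (dom ρ) (dom b))
    h = proj₂ (directed F (dom ρ) (dom b))

-- "a satisfies the pointwise predicate P on some base set", i.e. a factors
-- through the subobject y{x | P x} ↪ y A.
Loc : (F : FSet) {A : Set} → Elt F A → (A → Set) → Set
Loc F a P = Σ[ k ∈ Idx F ] Σ[ h ∈ Sub F k (dom a) ]
              (∀ c (p : Base F k c) → P (fun a c (h c p)))

record Cover (F : FSet) : Set₁ where
  field
    n      : ℕ
    obj    : Fin n → FSet
    mor    : (k : Fin n) → Mor (obj k) F
    covers : (js : (k : Fin n) → Idx (obj k)) →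
             Σ[ i ∈ Idx F ] (∀ c → Base F i c →
               Σ[ k ∈ Fin n ] Σ[ d ∈ Car (obj k) ]
               Σ[ p ∈ Base (obj k) (dom (mor k)) d ]
                 (Base (obj k) (js k) d × fun (mor k) d p ≡ c))
open Cover public

data Sort (B : Set) : Set where
  base : B → Sort B
  _*   : Sort B → Sort B

⟦_⟧[_] : {B : Set} → Sort B → (B → Set) → Set
⟦ base b ⟧[ I ] = I b
⟦ S * ⟧[ I ]    = List ⟦ S ⟧[ I ]

record Language : Set₁ where
  field
    BSort  : Set
    ⟦_⟧B   : BSort → Set
    FunSym : List (Sort BSort) → Sort BSort → Set
    RelSym : List (Sort BSort) → Set
    funI   : ∀ {as s} → FunSym as s → All (λ S → ⟦ S ⟧[ ⟦_⟧B ]) as → ⟦ s ⟧[ ⟦_⟧B ]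
    relI   : ∀ {as} → RelSym as → All (λ S → ⟦ S ⟧[ ⟦_⟧B ]) as → Set
open Language public

module _ (L : Language) where

  Ty : Set
  Ty = Sort (BSort L)

  ⟦_⟧ : Ty → Set
  ⟦ S ⟧ = ⟦ S ⟧[ ⟦_⟧B L ]

  Ctx : Set
  Ctx = List Ty

  Env : Ctx → Set
  Env Γ = All ⟦_⟧ Γ

  mutual
    data Term (Γ : Ctx) : Ty → Set where
      var : ∀ {S} → S ∈ Γ → Term Γ S
      app : ∀ {as S} → FunSym L as S → Terms Γ as → Term Γ S

    data Terms (Γ : Ctx) : List Ty → Set where
      []  : Terms Γ []
      _∷_ : ∀ {S as} → Term Γ S → Terms Γ as → Terms Γ (S ∷ as)

  data Formula (Γ : Ctx) : Set where
    rel   : ∀ {as} → RelSym L as → Terms Γ as → Formula Γ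
    _≐_   : ∀ {S} → Term Γ S → Term Γ S → Formula Γ
    _∈ₜ_  : ∀ {S} → Term Γ S → Term Γ (S *) → Formula Γ
    st    : ∀ {S} → Term Γ S → Formula Γ
    ⊤f ⊥f : Formula Γ
    _∧f_ _∨f_ _⇒f_ : Formula Γ → Formula Γ → Formula Γ
    ∀f ∃f : (S : Ty) → Formula (S ∷ Γ) → Formula Γ

  ∀st ∃st : {Γ : Ctx} (S : Ty) → Formula (S ∷ Γ) → Formula Γ
  ∀st S φ = ∀f S (st (var (here refl)) ⇒f φ)
  ∃st S φ = ∃f S (st (var (here refl)) ∧f φ)

  Ren : Ctx → Ctx → Set
  Ren Γ Δ = ∀ {S} → S ∈ Γ → S ∈ Δ

  liftR : ∀ {Γ Δ S} → Ren Γ Δ → Ren (S ∷ Γ) (S ∷ Δ)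
  liftR r (here e)  = here e
  liftR r (there x) = there (r x)

  mutual
    renT : ∀ {Γ Δ S} → Ren Γ Δ → Term Γ S → Term Δ S
    renT r (var x)    = var (r x)
    renT r (app f ts) = app f (renTs r ts)

    renTs : ∀ {Γ Δ as} → Ren Γ Δ → Terms Γ as → Terms Δ as
    renTs r []       = []
    renTs r (t ∷ ts) = renT r t ∷ renTs r ts

  renF : ∀ {Γ Δ} → Ren Γ Δ → Formula Γ → Formula Δ
  renF r (rel R ts) = rel R (renTs r ts)
  renF r (s ≐ t)    = renT r s ≐ renT r t
  renF r (s ∈ₜ t)   = renT r s ∈ₜ renT r t
  renF r (st t)     = st (renT r t)
  renF r ⊤f         = ⊤f
  renF r ⊥f         = ⊥f
  renF r (φ ∧f ψ)   = renF r φ ∧f renF r ψ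
  renF r (φ ∨f ψ)   = renF r φ ∨f renF r ψ
  renF r (φ ⇒f ψ)   = renF r φ ⇒f renF r ψ
  renF r (∀f S φ)   = ∀f S (renF (liftR r) φ)
  renF r (∃f S φ)   = ∃f S (renF (liftR r) φ)

  mutual
    evalT : ∀ {Γ S} → Term Γ S → Env Γ → ⟦ S ⟧
    evalT (var x)    e = All.lookup e x
    evalT (app f ts) e = funI L f (evalTs ts e)

    evalTs : ∀ {Γ as} → Terms Γ as → Env Γ → All ⟦_⟧ as
    evalTs []       e = []
    evalTs (t ∷ ts) e = evalT t e ∷ evalTs ts e

  data _∈L_ {A : Set} (x : A) : List A → Set where
    here  : ∀ {xs} → x ∈L (x ∷ xs)
    there : ∀ {y xs} → x ∈L xs → x ∈L (y ∷ xs)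

  -- Kripke–Joyal forcing in N = Sh(𝔉Set, K), for the interpretation
  -- S ↦ y S, symbols via Yoneda, st_S ↦ Δ S.
  _⊩_[_] : ∀ {Γ} (F : FSet) → Formula Γ → Elt F (Env Γ) → Set₁
  F ⊩ rel R ts [ ρ ] = Lift _ (Loc F ρ (λ e → relI L R (evalTs ts e)))
  F ⊩ s ≐ t    [ ρ ] = Lift _ (Loc F ρ (λ e → evalT s e ≡ evalT t e))
  F ⊩ s ∈ₜ t   [ ρ ] = Lift _ (Loc F ρ (λ e → evalT s e ∈L evalT t e))
  -- the element t ∈ (y S)(F) lies in (Δ S)(F): on some base set it takes
  -- only finitely many values
  F ⊩ st {S} t [ ρ ] = Lift _ (Σ[ vs ∈ List ⟦ S ⟧ ] Loc F ρ (λ e → evalT t e ∈L vs))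
  F ⊩ ⊤f       [ ρ ] = Lift _ ⊤
  -- the empty family covers F
  F ⊩ ⊥f       [ ρ ] = Lift _ (Σ[ i ∈ Idx F ] (∀ c → Base F i c → ⊥))
  F ⊩ φ ∧f ψ   [ ρ ] = (F ⊩ φ [ ρ ]) × (F ⊩ ψ [ ρ ])
  F ⊩ φ ∨f ψ   [ ρ ] = Σ[ 𝒞 ∈ Cover F ] ((k : Fin (n 𝒞)) →
                          (obj 𝒞 k ⊩ φ [ restrict (mor 𝒞 k) ρ ]) ⊎
                          (obj 𝒞 k ⊩ ψ [ restrict (mor 𝒞 k) ρ ]))
  F ⊩ φ ⇒f ψ   [ ρ ] = (G : FSet) (β : Mor G F) →
                          G ⊩ φ [ restrict β ρ ] → G ⊩ ψ [ restrict β ρ ]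
  F ⊩ ∀f S φ   [ ρ ] = (G : FSet) (β : Mor G F) (b : Elt G ⟦ S ⟧) →
                          G ⊩ φ [ extend (restrict β ρ) b ]
  F ⊩ ∃f S φ   [ ρ ] = Σ[ 𝒞 ∈ Cover F ] ((k : Fin (n 𝒞)) →
                          Σ[ b ∈ Elt (obj 𝒞 k) ⟦ S ⟧ ]
                            (obj 𝒞 k ⊩ φ [ extend (restrict (mor 𝒞 k) ρ) b ]))

  Valid : Formula [] → Set₁
  Valid φ = (F : FSet) (ρ : Elt F (Env [])) → F ⊩ φ [ ρ ]

  closeAll : (Γ : Ctx) → Formula Γ → Formula []
  closeAll []      φ = φ
  closeAll (S ∷ Γ) φ = closeAll Γ (∀f S φ)

  -- the instance of NCR for Φ(x,y) with x : S (variable 0), y : T (variable 1)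
  -- and further free variables Γ:
  -- ∀y:T ∃st x:S Φ(x,y) → ∃st s:S* ∀y:T ∃x ∈ s Φ(x,y)
  NCR : (S T : Ty) {Γ : Ctx} → Formula (S ∷ T ∷ Γ) → Formula Γ
  NCR S T Φ =
    ∀f T (∃st S Φ)
    ⇒f ∃st (S *) (∀f T (∃f S
         ((var (here refl) ∈ₜ var (there (there (here refl))))
          ∧f renF (liftR (liftR there)) Φ)))

{-# OPTIONS --safe #-}
-- Suppose ∀y ∃st x Φ(x,y) is forced at a stage H. Apply it to the generic
-- element of T, which lives at the stage H × T (base sets H_i × T). This gives
-- a finite cover of H × T and on its k-th piece an x_k satisfying Φ(x_k, y)
-- that takes values in a finite list vs_k on a base set. The constant list
-- s = vs_1 ++ … ++ vs_n is standard, and it serves every y' : T at every stage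
-- δ : G → H: pulling the cover back along (δ, y') : G → H × T restricts x_k to
-- a witness in s, and forcing is stable under restriction and renaming.
module Submission where

open import Level using (lift; lower)
open import Data.Product using (Σ-syntax; _×_; _,_; proj₁; proj₂)
import Data.Sum as Sum
open import Data.Unit using (tt)
open import Function using (_∘_)
open import Data.Nat using (ℕ; zero; suc)
open import Data.Fin using (Fin; zero; suc)
open import Data.List using (List; []; _∷_; concat; tabulate)
open import Data.List.Relation.Unary.All as All using (_∷_)
open import Data.List.Relation.Unary.Any using (here; there)
open import Data.List.Membership.Propositional using (_∈_)
open import Data.List.Membership.Propositional.Properties using (∈-concat⁺′; ∈-tabulate⁺)
open import Relation.Binary.PropositionalEquality
  using (_≡_; refl; sym; trans; cong; cong₂; subst; subst₂)

open import Defs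

fun-cong : {F G : FSet} (a : Mor F G) {c c' : Car F} → c ≡ c' →
           (p : Base F (dom a) c) (p' : Base F (dom a) c') → fun a c p ≡ fun a c' p'
fun-cong {F} a {c} refl p p' = cong (fun a c) (Base-prop F (dom a) c p p')

idM : (F : FSet) → Mor F F
idM F = record
  { dom  = inhabited F
  ; fun  = λ c _ → c
  ; cont = directed F (inhabited F) }

infixr 9 _∘M_
_∘M_ : {H G F : FSet} → Mor G F → Mor H G → Mor H F
_∘M_ {H} {G} {F} γ β = record
  { dom  = proj₁ (cont β (dom γ))
  ; fun  = λ c p → let (q , q') = proj₂ (cont β (dom γ)) c p in fun γ (fun β c q) q'
  ; cont = cont-∘ }
  where
    cont-∘ : ∀ j → Σ[ i ∈ Idx H ] (∀ c → (p : Base H i c) →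
               Σ[ q ∈ Base H (proj₁ (cont β (dom γ))) c ]
                 Base F j (let (r , r') = proj₂ (cont β (dom γ)) c q in fun γ (fun β c r) r'))
    cont-∘ j =
      let (iγ , hγ) = cont γ j ; (iβ , hβ) = cont β iγ
          (i , hi) = directed H iβ (proj₁ (cont β (dom γ)))
      in i , λ c p →
        let (pβ , pdom) = hi c p ; (q , qγ) = hβ c pβ ; (r , rj) = hγ (fun β c q) qγ
        in pdom , subst (Base F j) (fun-cong γ (fun-cong β refl q _) r _) rj

constElt : (F : FSet) {A : Set} → A → Elt F A
constElt F a = record
  { dom = inhabited F ; fun = λ _ _ → a ; cont = λ _ → inhabited F , λ _ p → p , tt }

finite-meet : (F : FSet) {n : ℕ} (i : Idx F) (js : Fin n → Idx F) →
  Σ[ k ∈ Idx F ] (∀ c → Base F k c → Base F i c × (∀ m → Base F (js m) c))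
finite-meet F {zero}  i js = i , λ c p → p , λ ()
finite-meet F {suc n} i js =
  let (k , below) = finite-meet F i (λ m → js (suc m))
      (k' , below') = directed F k (js zero)
  in k' , λ c p →
    let (pk , p₀) = below' c p ; (pi , pjs) = below c pk
    in pi , λ { zero → p₀ ; (suc m) → pjs m }

-- With R = _≡_ this says that a and b represent the same morphism.
record Loc₂ (F : FSet) {A B : Set} (a : Elt F A) (b : Elt F B) (R : A → B → Set) : Set where
  constructor loc₂
  field
    at      : Idx F
    related : ∀ c → Base F at c →
              Base F (dom a) c × Base F (dom b) c × (∀ p q → R (fun a c p) (fun b c q))

module _ {F : FSet} {A B : Set} {a : Elt F A} {b : Elt F B} where

  Loc₂-global : {R : A → B → Set} → (∀ c p q → R (fun a c p) (fun b c q)) → Loc₂ F a b R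
  Loc₂-global R-everywhere =
    let (k , below) = directed F (dom a) (dom b)
    in loc₂ k λ c p → proj₁ (below c p) , proj₂ (below c p) , R-everywhere c

  Loc₂-map : {R R' : A → B → Set} → (∀ {u v} → R u v → R' u v) →
    Loc₂ F a b R → Loc₂ F a b R'
  Loc₂-map f (loc₂ k near) = loc₂ k λ c p →
    let (pa , pb , R-at) = near c p in pa , pb , λ p' q' → f (R-at p' q')

  Loc₂-flip : {R : A → B → Set} → Loc₂ F a b R → Loc₂ F b a (λ v u → R u v)
  Loc₂-flip (loc₂ k near) = loc₂ k λ c p →
    let (pa , pb , R-at) = near c p in pb , pa , λ q' p' → R-at p' q'

  Loc-transport : {P : A → Set} {R : A → B → Set} {Q : B → Set} →
    Loc F a P → Loc₂ F a b R → (∀ {u v} → P u → R u v → Q v) → Loc F b Q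
  Loc-transport (k , sub , P-at) (loc₂ k' near) f =
    let (k'' , below) = directed F k k'
    in k'' , (λ c p → proj₁ (proj₂ (near c (proj₂ (below c p))))) , λ c p →
      let (pk , pk') = below c p ; (pa , pb , R-at) = near c pk'
      in f (P-at c pk) (R-at (sub c pk) pb)

Loc₂-sym : {F : FSet} {A : Set} {a b : Elt F A} → Loc₂ F a b _≡_ → Loc₂ F b a _≡_
Loc₂-sym r = Loc₂-map sym (Loc₂-flip r)

Loc⇒Loc₂ : {F : FSet} {A : Set} {a : Elt F A} {P : A → Set} → Loc F a P → Loc₂ F a a (λ _ → P)
Loc⇒Loc₂ {a = a} {P} (k , sub , P-at) = loc₂ k λ c p →
  sub c p , sub c p , λ _ q → subst P (fun-cong a refl (sub c p) q) (P-at c p)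

Loc₂⇒Loc : {F : FSet} {A B : Set} {a : Elt F A} {b : Elt F B} {P : B → Set} →
  Loc₂ F a b (λ _ → P) → Loc F b P
Loc₂⇒Loc (loc₂ k near) =
  k , (λ c p → proj₁ (proj₂ (near c p))) , λ c p →
    let (pa , pb , P-at) = near c p in P-at pa pb

related-at-equal : {F : FSet} {A B : Set} (a : Elt F A) (b : Elt F B) {R : A → B → Set}
  {c c₁ c₂ : Car F} → c ≡ c₁ → c ≡ c₂ →
  (∀ p q → R (fun a c p) (fun b c q)) → ∀ p q → R (fun a c₁ p) (fun b c₂ q)
related-at-equal a b refl refl R-at = R-at

Loc₂-restrict : {G F : FSet} {A B : Set} {a : Elt F A} {b : Elt F B} {R : A → B → Set} →
  Loc₂ F a b R → (γ : Mor G F) → Loc₂ G (restrict γ a) (restrict γ b) R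
Loc₂-restrict {G} {a = a} {b} {R} (loc₂ k near) γ =
  let (iγ , hγ) = cont γ k
      (i , below) = directed G iγ (dom (restrict γ a))
      (i' , below') = directed G i (dom (restrict γ b))
  in loc₂ i' λ c p →
    let (pi , pb) = below' c p ; (pγ , pa) = below c pi
        (q , qk) = hγ c pγ ; (_ , _ , R-at) = near (fun γ c q) qk
    in pa , pb , λ _ _ →
      related-at-equal a b {R = R} (fun-cong γ refl q _) (fun-cong γ refl q _) R-at _ _

Loc-restrict : {G F : FSet} {A : Set} (a : Elt F A) (P : A → Set) →
  Loc F a P → (γ : Mor G F) → Loc G (restrict γ a) P
Loc-restrict a P l γ = Loc₂⇒Loc (Loc₂-restrict {a = a} {b = a} {R = λ _ → P} (Loc⇒Loc₂ l) γ)

Loc₂-comp : {H G F : FSet} {A : Set} (a : Elt F A) (γ : Mor G F) (β : Mor H G) →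
  Loc₂ H (restrict β (restrict γ a)) (restrict (γ ∘M β) a) _≡_
Loc₂-comp a γ β = Loc₂-global λ c p q → fun-cong a (fun-cong γ (fun-cong β refl _ _) _ _) _ _

record PBPoint {F G H : FSet} (β : Mor G F) (γ : Mor H F) : Set where
  constructor pbPoint
  field
    pt₁  : Car G
    pt₂  : Car H
    def₁ : Base G (dom β) pt₁
    def₂ : Base H (dom γ) pt₂
    glue : fun β pt₁ def₁ ≡ fun γ pt₂ def₂
open PBPoint

glue′ : {F G H : FSet} {β : Mor G F} {γ : Mor H F} (d : PBPoint β γ)
  (p : Base G (dom β) (pt₁ d)) (q : Base H (dom γ) (pt₂ d)) → fun β (pt₁ d) p ≡ fun γ (pt₂ d) q
glue′ {β = β} {γ} d p q =
  trans (fun-cong β refl p (def₁ d)) (trans (glue d) (fun-cong γ refl (def₂ d) q))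

Pullback : {F G H : FSet} (β : Mor G F) (γ : Mor H F) → FSet
Pullback {F} {G} {H} β γ = record
  { Car       = PBPoint β γ
  ; Idx       = Idx G × Idx H
  ; Base      = λ (j , j') d → Base G j (pt₁ d) × Base H j' (pt₂ d)
  ; Base-prop = λ (j , j') d (x , x') (y , y') →
                  cong₂ _,_ (Base-prop G j (pt₁ d) x y) (Base-prop H j' (pt₂ d) x' y')
  ; inhabited = inhabited G , inhabited H
  ; directed  = λ (j₁ , j₁') (j₂ , j₂') →
      let (j , hj) = directed G j₁ j₂ ; (j' , hj') = directed H j₁' j₂'
      in (j , j') , λ d (x , x') →
        let (x₁ , x₂) = hj (pt₁ d) x ; (x₁' , x₂') = hj' (pt₂ d) x'
        in (x₁ , x₁') , (x₂ , x₂') }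

-- Every point of the pullback lies in the base set (dom β , dom γ), which
-- therefore serves as the domain of both projections.
π₁ : {F G H : FSet} (β : Mor G F) (γ : Mor H F) → Mor (Pullback β γ) G
π₁ β γ = record
  { dom  = dom β , dom γ
  ; fun  = λ d _ → pt₁ d
  ; cont = λ j → (j , dom γ) , λ d (x , _) → (def₁ d , def₂ d) , x }

π₂ : {F G H : FSet} (β : Mor G F) (γ : Mor H F) → Mor (Pullback β γ) H
π₂ β γ = record
  { dom  = dom β , dom γ
  ; fun  = λ d _ → pt₂ d
  ; cont = λ j → (dom β , j) , λ d (_ , x) → (def₁ d , def₂ d) , x }

Loc₂-pullback-square : {F G H : FSet} {A : Set} (a : Elt F A) (β : Mor G F) (γ : Mor H F) →
  Loc₂ (Pullback β γ) (restrict (π₁ β γ) (restrict β a))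
                      (restrict (π₂ β γ) (restrict γ a)) _≡_
Loc₂-pullback-square a β γ = Loc₂-global λ d _ _ → fun-cong a (glue′ d _ _) _ _

-- Pull the chosen base set of F back along γ and intersect it with the
-- finitely many chosen base sets of H; a point h of this set has γ h in
-- the image of some β_k, which yields a pullback point over h.
Cover-pullback : {F H : FSet} → Cover F → Mor H F → Cover H
Cover-pullback {F} {H} 𝒞 γ = record
  { n      = n 𝒞
  ; obj    = λ k → Pullback (mor 𝒞 k) γ
  ; mor    = λ k → π₂ (mor 𝒞 k) γ
  ; covers = λ js →
      let (iF , covered) = covers 𝒞 (λ k → proj₁ (js k))
          (iγ , hγ) = cont γ iF
          (i , below) = finite-meet H iγ (λ k → proj₂ (js k))
      in i , λ h p →
        let (pγ , pjs) = below h p ; (q , qF) = hγ h pγ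
            (k , g , pβ , pj , eq) = covered (fun γ h q) qF
        in k , pbPoint g h pβ q eq , (pβ , q) , (pj , pjs k) , refl }

idCover : (F : FSet) → Cover F
idCover F = record
  { n      = 1
  ; obj    = λ _ → F
  ; mor    = λ _ → idM F
  ; covers = λ js →
      let (i , below) = directed F (inhabited F) (js zero)
      in i , λ c p → zero , c , proj₁ (below c p) , proj₂ (below c p) , refl }

module _ (L : Language) where

  record Agree {Γ Δ : Ctx L} (r : Ren L Γ Δ) (e : Env L Γ) (e' : Env L Δ) : Set where
    constructor agree
    field lookup-agree : ∀ {S} (x : S ∈ Γ) → All.lookup e x ≡ All.lookup e' (r x)
  open Agree

  mutual
    evalT-rename : {Γ Δ : Ctx L} (r : Ren L Γ Δ) {S : Ty L} (t : Term L Γ S)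
      {e : Env L Γ} {e' : Env L Δ} → Agree r e e' → evalT L t e ≡ evalT L (renT L r t) e'
    evalT-rename r (var x)    e~e' = lookup-agree e~e' x
    evalT-rename r (app f ts) e~e' = cong (funI L f) (evalTs-rename r ts e~e')

    evalTs-rename : {Γ Δ : Ctx L} (r : Ren L Γ Δ) {as : List (Ty L)} (ts : Terms L Γ as)
      {e : Env L Γ} {e' : Env L Δ} → Agree r e e' → evalTs L ts e ≡ evalTs L (renTs L r ts) e'
    evalTs-rename r []       e~e' = refl
    evalTs-rename r (t ∷ ts) e~e' = cong₂ _∷_ (evalT-rename r t e~e') (evalTs-rename r ts e~e')

  Loc₂-extend : {F : FSet} {Γ Δ : Ctx L} {r : Ren L Γ Δ} {S : Ty L}
    {ρ : Elt F (Env L Γ)} {σ : Elt F (Env L Δ)} →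
    Loc₂ F ρ σ (Agree r) → (b : Elt F (⟦_⟧ L S)) →
    Loc₂ F (extend {P = ⟦_⟧ L} {x = S} ρ b) (extend {P = ⟦_⟧ L} {x = S} σ b) (Agree (liftR L r))
  Loc₂-extend {F} {S = S} {ρ} {σ} (loc₂ k near) b =
    let (i , below) = directed F k (dom (extend {P = ⟦_⟧ L} {x = S} ρ b))
        (i' , below') = directed F i (dom (extend {P = ⟦_⟧ L} {x = S} σ b))
    in loc₂ i' λ c p →
      let (pi , pσ) = below' c p ; (pk , pρ) = below c pi
          (_ , _ , agree-at) = near c pk
      in pρ , pσ , λ _ _ → agree λ where
           (here refl) → fun-cong b refl _ _
           (there x)   → lookup-agree (agree-at _ _) x

  mutual
    ⊩-rename : {Γ Δ : Ctx L} (r : Ren L Γ Δ) (φ : Formula L Γ) {F : FSet}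
      {ρ : Elt F (Env L Γ)} {σ : Elt F (Env L Δ)} →
      Loc₂ F ρ σ (Agree r) → _⊩_[_] L F φ ρ → _⊩_[_] L F (renF L r φ) σ
    ⊩-rename r (rel R ts) ρ~σ (lift l) =
      lift (Loc-transport l ρ~σ λ holds e~e' → subst (relI L R) (evalTs-rename r ts e~e') holds)
    ⊩-rename r (s ≐ t) ρ~σ (lift l) =
      lift (Loc-transport l ρ~σ λ s≡t e~e' →
        trans (sym (evalT-rename r s e~e')) (trans s≡t (evalT-rename r t e~e')))
    ⊩-rename r (s ∈ₜ t) ρ~σ (lift l) =
      lift (Loc-transport l ρ~σ λ s∈t e~e' →
        subst₂ (_∈L_ L) (evalT-rename r s e~e') (evalT-rename r t e~e') s∈t)
    ⊩-rename r (st t) ρ~σ (lift (vs , l)) =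
      lift (vs , Loc-transport l ρ~σ λ t∈vs e~e' →
        subst (λ v → _∈L_ L v vs) (evalT-rename r t e~e') t∈vs)
    ⊩-rename r ⊤f       ρ~σ h         = h
    ⊩-rename r ⊥f       ρ~σ h         = h
    ⊩-rename r (φ ∧f ψ) ρ~σ (hφ , hψ) = ⊩-rename r φ ρ~σ hφ , ⊩-rename r ψ ρ~σ hψ
    ⊩-rename r (φ ∨f ψ) ρ~σ (𝒞 , h)   = 𝒞 , λ k →
      Sum.map (⊩-rename r φ (Loc₂-restrict ρ~σ (mor 𝒞 k)))
              (⊩-rename r ψ (Loc₂-restrict ρ~σ (mor 𝒞 k))) (h k)
    ⊩-rename r (φ ⇒f ψ) ρ~σ h G β hφ  =
      ⊩-rename r ψ (Loc₂-restrict ρ~σ β) (h G β (⊩-rename⁻¹ r φ (Loc₂-restrict ρ~σ β) hφ))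
    ⊩-rename r (∀f S φ) ρ~σ h G β b   =
      ⊩-rename (liftR L r) φ (Loc₂-extend (Loc₂-restrict ρ~σ β) b) (h G β b)
    ⊩-rename r (∃f S φ) ρ~σ (𝒞 , h)   = 𝒞 , λ k →
      let (b , hφ) = h k
      in b , ⊩-rename (liftR L r) φ (Loc₂-extend (Loc₂-restrict ρ~σ (mor 𝒞 k)) b) hφ

    ⊩-rename⁻¹ : {Γ Δ : Ctx L} (r : Ren L Γ Δ) (φ : Formula L Γ) {F : FSet}
      {ρ : Elt F (Env L Γ)} {σ : Elt F (Env L Δ)} →
      Loc₂ F ρ σ (Agree r) → _⊩_[_] L F (renF L r φ) σ → _⊩_[_] L F φ ρ
    ⊩-rename⁻¹ r (rel R ts) ρ~σ (lift l) =
      lift (Loc-transport l (Loc₂-flip ρ~σ) λ holds e~e' →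
        subst (relI L R) (sym (evalTs-rename r ts e~e')) holds)
    ⊩-rename⁻¹ r (s ≐ t) ρ~σ (lift l) =
      lift (Loc-transport l (Loc₂-flip ρ~σ) λ s≡t e~e' →
        trans (evalT-rename r s e~e') (trans s≡t (sym (evalT-rename r t e~e'))))
    ⊩-rename⁻¹ r (s ∈ₜ t) ρ~σ (lift l) =
      lift (Loc-transport l (Loc₂-flip ρ~σ) λ s∈t e~e' →
        subst₂ (_∈L_ L) (sym (evalT-rename r s e~e')) (sym (evalT-rename r t e~e')) s∈t)
    ⊩-rename⁻¹ r (st t) ρ~σ (lift (vs , l)) =
      lift (vs , Loc-transport l (Loc₂-flip ρ~σ) λ t∈vs e~e' →
        subst (λ v → _∈L_ L v vs) (sym (evalT-rename r t e~e')) t∈vs)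
    ⊩-rename⁻¹ r ⊤f       ρ~σ h         = h
    ⊩-rename⁻¹ r ⊥f       ρ~σ h         = h
    ⊩-rename⁻¹ r (φ ∧f ψ) ρ~σ (hφ , hψ) =
      ⊩-rename⁻¹ r φ ρ~σ hφ , ⊩-rename⁻¹ r ψ ρ~σ hψ
    ⊩-rename⁻¹ r (φ ∨f ψ) ρ~σ (𝒞 , h)   = 𝒞 , λ k →
      Sum.map (⊩-rename⁻¹ r φ (Loc₂-restrict ρ~σ (mor 𝒞 k)))
              (⊩-rename⁻¹ r ψ (Loc₂-restrict ρ~σ (mor 𝒞 k))) (h k)
    ⊩-rename⁻¹ r (φ ⇒f ψ) ρ~σ h G β hφ  =
      ⊩-rename⁻¹ r ψ (Loc₂-restrict ρ~σ β) (h G β (⊩-rename r φ (Loc₂-restrict ρ~σ β) hφ))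
    ⊩-rename⁻¹ r (∀f S φ) ρ~σ h G β b   =
      ⊩-rename⁻¹ (liftR L r) φ (Loc₂-extend (Loc₂-restrict ρ~σ β) b) (h G β b)
    ⊩-rename⁻¹ r (∃f S φ) ρ~σ (𝒞 , h)   = 𝒞 , λ k →
      let (b , hφ) = h k
      in b , ⊩-rename⁻¹ (liftR L r) φ (Loc₂-extend (Loc₂-restrict ρ~σ (mor 𝒞 k)) b) hφ

  mutual
    renT-id : {Γ : Ctx L} (r : Ren L Γ Γ) → (∀ {S} (x : S ∈ Γ) → r x ≡ x) →
      {S : Ty L} (t : Term L Γ S) → renT L r t ≡ t
    renT-id r r≗id (var x)    = cong var (r≗id x)
    renT-id r r≗id (app f ts) = cong (app f) (renTs-id r r≗id ts)

    renTs-id : {Γ : Ctx L} (r : Ren L Γ Γ) → (∀ {S} (x : S ∈ Γ) → r x ≡ x) →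
      {as : List (Ty L)} (ts : Terms L Γ as) → renTs L r ts ≡ ts
    renTs-id r r≗id []       = refl
    renTs-id r r≗id (t ∷ ts) = cong₂ _∷_ (renT-id r r≗id t) (renTs-id r r≗id ts)

  liftR-id : {Γ : Ctx L} {T : Ty L} (r : Ren L Γ Γ) → (∀ {S} (x : S ∈ Γ) → r x ≡ x) →
    ∀ {S} (x : S ∈ T ∷ Γ) → liftR L r x ≡ x
  liftR-id r r≗id (here _)  = refl
  liftR-id r r≗id (there x) = cong there (r≗id x)

  renF-id : {Γ : Ctx L} (r : Ren L Γ Γ) → (∀ {S} (x : S ∈ Γ) → r x ≡ x) →
    (φ : Formula L Γ) → renF L r φ ≡ φ
  renF-id r r≗id (rel R ts) = cong (rel R) (renTs-id r r≗id ts)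
  renF-id r r≗id (s ≐ t)    = cong₂ _≐_ (renT-id r r≗id s) (renT-id r r≗id t)
  renF-id r r≗id (s ∈ₜ t)   = cong₂ _∈ₜ_ (renT-id r r≗id s) (renT-id r r≗id t)
  renF-id r r≗id (st t)     = cong st (renT-id r r≗id t)
  renF-id r r≗id ⊤f         = refl
  renF-id r r≗id ⊥f         = refl
  renF-id r r≗id (φ ∧f ψ)   = cong₂ _∧f_ (renF-id r r≗id φ) (renF-id r r≗id ψ)
  renF-id r r≗id (φ ∨f ψ)   = cong₂ _∨f_ (renF-id r r≗id φ) (renF-id r r≗id ψ)
  renF-id r r≗id (φ ⇒f ψ)   = cong₂ _⇒f_ (renF-id r r≗id φ) (renF-id r r≗id ψ)
  renF-id r r≗id (∀f S φ)   = cong (∀f S) (renF-id (liftR L r) (liftR-id r r≗id) φ)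
  renF-id r r≗id (∃f S φ)   = cong (∃f S) (renF-id (liftR L r) (liftR-id r r≗id) φ)

  ⊩-resp-≈ : {Γ : Ctx L} (φ : Formula L Γ) {F : FSet} {ρ σ : Elt F (Env L Γ)} →
    Loc₂ F ρ σ _≡_ → _⊩_[_] L F φ ρ → _⊩_[_] L F φ σ
  ⊩-resp-≈ φ {F} {σ = σ} ρ≈σ h =
    subst (λ ψ → _⊩_[_] L F ψ σ) (renF-id (λ x → x) (λ _ → refl) φ)
      (⊩-rename (λ x → x) φ (Loc₂-map (λ { refl → agree λ _ → refl }) ρ≈σ) h)

  ⊩-restrict : {Γ : Ctx L} (φ : Formula L Γ) {F G : FSet} (ρ : Elt F (Env L Γ)) (γ : Mor G F) →
    _⊩_[_] L F φ ρ → _⊩_[_] L G φ (restrict γ ρ)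
  ⊩-restrict (rel R ts) ρ γ (lift l) =
    lift (Loc-restrict ρ (λ e → relI L R (evalTs L ts e)) l γ)
  ⊩-restrict (s ≐ t) ρ γ (lift l) =
    lift (Loc-restrict ρ (λ e → evalT L s e ≡ evalT L t e) l γ)
  ⊩-restrict (s ∈ₜ t) ρ γ (lift l) =
    lift (Loc-restrict ρ (λ e → _∈L_ L (evalT L s e) (evalT L t e)) l γ)
  ⊩-restrict (st t) ρ γ (lift (vs , l)) =
    lift (vs , Loc-restrict ρ (λ e → _∈L_ L (evalT L t e) vs) l γ)
  ⊩-restrict ⊤f ρ γ h = h
  ⊩-restrict ⊥f ρ γ (lift (i , empty)) =
    let (i' , hγ) = cont γ i in lift (i' , λ c p → empty _ (proj₂ (hγ c p)))
  ⊩-restrict (φ ∧f ψ) ρ γ (hφ , hψ) = ⊩-restrict φ ρ γ hφ , ⊩-restrict ψ ρ γ hψ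
  ⊩-restrict (φ ∨f ψ) ρ γ (𝒞 , h) = Cover-pullback 𝒞 γ , λ k →
    let square = Loc₂-pullback-square ρ (mor 𝒞 k) γ ; π₁ₖ = π₁ (mor 𝒞 k) γ
    in Sum.map (⊩-resp-≈ φ square ∘ ⊩-restrict φ _ π₁ₖ)
               (⊩-resp-≈ ψ square ∘ ⊩-restrict ψ _ π₁ₖ) (h k)
  ⊩-restrict (φ ⇒f ψ) ρ γ h G β hφ =
    ⊩-resp-≈ ψ (Loc₂-sym (Loc₂-comp ρ γ β))
      (h G (γ ∘M β) (⊩-resp-≈ φ (Loc₂-comp ρ γ β) hφ))
  ⊩-restrict (∀f S φ) ρ γ h G β b =
    ⊩-resp-≈ φ (Loc₂-global λ _ _ _ → cong₂ _∷_ (fun-cong b refl _ _)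
                  (fun-cong ρ (fun-cong γ (fun-cong β refl _ _) _ _) _ _))
      (h G (γ ∘M β) b)
  ⊩-restrict (∃f S φ) ρ γ (𝒞 , h) = Cover-pullback 𝒞 γ , λ k →
    let (b , hφ) = h k
    in restrict (π₁ (mor 𝒞 k) γ) b ,
       ⊩-resp-≈ φ (Loc₂-global λ d _ _ →
                     cong₂ _∷_ (fun-cong b refl _ _) (fun-cong ρ (glue′ d _ _) _ _))
         (⊩-restrict φ _ (π₁ (mor 𝒞 k) γ) hφ)

  Valid-closeAll : (Γ : Ctx L) (φ : Formula L Γ) →
    (∀ F ρ → _⊩_[_] L F φ ρ) → Valid L (closeAll L Γ φ)
  Valid-closeAll []      φ forced = forced
  Valid-closeAll (S ∷ Γ) φ forced =
    Valid-closeAll Γ (∀f S φ) λ F ρ G β b → forced G (extend (restrict β ρ) b)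

_×ₛ_ : FSet → Set → FSet
F ×ₛ T = record
  { Car       = Car F × T
  ; Idx       = Idx F
  ; Base      = λ i (c , _) → Base F i c
  ; Base-prop = λ i (c , _) → Base-prop F i c
  ; inhabited = inhabited F
  ; directed  = λ i j → let (k , below) = directed F i j in k , λ (c , _) → below c }

π-stage : (F : FSet) (T : Set) → Mor (F ×ₛ T) F
π-stage F T = record
  { dom  = inhabited F
  ; fun  = λ (c , _) _ → c
  ; cont = λ j → let (k , below) = directed F (inhabited F) j in k , λ (c , _) → below c }

generic : (F : FSet) (T : Set) → Elt (F ×ₛ T) T
generic F T = record
  { dom = inhabited F ; fun = λ (_ , t) _ → t ; cont = λ _ → inhabited F , λ _ p → p , tt }

⟨_,_⟩ : {G F : FSet} {T : Set} → Mor G F → Elt G T → Mor G (F ×ₛ T)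
⟨_,_⟩ {G} {F} δ y = record
  { dom  = proj₁ (directed G (dom δ) (dom y))
  ; fun  = λ c p → let (pδ , py) = proj₂ (directed G (dom δ) (dom y)) c p in fun δ c pδ , fun y c py
  ; cont = λ j →
      let (iδ , hδ) = cont δ j
          (i , below) = directed G iδ (proj₁ (directed G (dom δ) (dom y)))
      in i , λ c p →
        let (piδ , pdom) = below c p ; (q , qj) = hδ c piδ
        in pdom , subst (Base F j) (fun-cong δ refl q _) qj }

module _ (L : Language) where

  ∈⇒∈L : {A : Set} {x : A} {xs : List A} → x ∈ xs → _∈L_ L x xs
  ∈⇒∈L (here refl) = here
  ∈⇒∈L (there x∈xs) = there (∈⇒∈L x∈xs)

  ∈L⇒∈ : {A : Set} {x : A} {xs : List A} → _∈L_ L x xs → x ∈ xs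
  ∈L⇒∈ here = here refl
  ∈L⇒∈ (there x∈xs) = there (∈L⇒∈ x∈xs)

  ∈L-concat-tabulate : {A : Set} {x : A} {n : ℕ} (xss : Fin n → List A) (k : Fin n) →
    _∈L_ L x (xss k) → _∈L_ L x (concat (tabulate xss))
  ∈L-concat-tabulate xss k x∈xss = ∈⇒∈L (∈-concat⁺′ (∈L⇒∈ x∈xss) (∈-tabulate⁺ k))

module _ (L : Language) {S T : Ty L} {Γ : Ctx L} (Φ : Formula L (S ∷ T ∷ Γ)) where

  ∃∈Φ : Formula L (T ∷ (S *) ∷ Γ)
  ∃∈Φ = ∃f S ((var (here refl) ∈ₜ var (there (there (here refl))))
              ∧f renF L (liftR L (liftR L there)) Φ)

  module GenericInstance (H : FSet) (ρ : Elt H (Env L Γ))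
                         (hyp : _⊩_[_] L H (∀f T (∃st L S Φ)) ρ) where

    ρ-generic : Elt (H ×ₛ ⟦_⟧ L T) (Env L (T ∷ Γ))
    ρ-generic = extend (restrict (π-stage H _) ρ) (generic H _)

    at-generic : _⊩_[_] L (H ×ₛ ⟦_⟧ L T) (∃st L S Φ) ρ-generic
    at-generic = hyp _ (π-stage H _) (generic H _)

    𝒞 : Cover (H ×ₛ ⟦_⟧ L T)
    𝒞 = proj₁ at-generic

    x : (k : Fin (n 𝒞)) → Elt (obj 𝒞 k) (⟦_⟧ L S)
    x k = proj₁ (proj₂ at-generic k)

    ρ-x : (k : Fin (n 𝒞)) → Elt (obj 𝒞 k) (Env L (S ∷ T ∷ Γ))
    ρ-x k = extend (restrict (mor 𝒞 k) ρ-generic) (x k)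

    values : Fin (n 𝒞) → List (⟦_⟧ L S)
    values k = proj₁ (lower (proj₁ (proj₂ (proj₂ at-generic k))))

    head-∈ : List (⟦_⟧ L S) → Env L (S ∷ T ∷ Γ) → Set
    head-∈ vs e = _∈L_ L (All.lookup e (here refl)) vs

    x-standard : (k : Fin (n 𝒞)) → Loc (obj 𝒞 k) (ρ-x k) (head-∈ (values k))
    x-standard k = proj₂ (lower (proj₁ (proj₂ (proj₂ at-generic k))))

    x-Φ : (k : Fin (n 𝒞)) → _⊩_[_] L (obj 𝒞 k) Φ (ρ-x k)
    x-Φ k = proj₂ (proj₂ (proj₂ at-generic k))

    s : List (⟦_⟧ L S)
    s = concat (tabulate values)

    σ : Elt H (Env L ((S *) ∷ Γ))
    σ = extend (restrict (idM H) ρ) (constElt H s)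

    s-standard : _⊩_[_] L H (st (var (here refl))) σ
    s-standard = lift (s ∷ [] , _ , (λ _ p → p) , λ _ _ → here)

    r : Ren L (S ∷ T ∷ Γ) (S ∷ T ∷ (S *) ∷ Γ)
    r = liftR L (liftR L there)

    Agree-with-s : Env L (S ∷ T ∷ Γ) → Env L (S ∷ T ∷ (S *) ∷ Γ) → Set
    Agree-with-s u v = Agree L r u v × All.lookup v (there (there (here refl))) ≡ s

    ∈values⇒∈s : (k : Fin (n 𝒞)) → ∀ {u v} → head-∈ (values k) u → Agree-with-s u v →
      _∈L_ L (All.lookup v (here refl)) (All.lookup v (there (there (here refl))))
    ∈values⇒∈s k x∈values (u~v , v≡s) =
      subst₂ (_∈L_ L) (Agree.lookup-agree u~v (here refl)) (sym v≡s)
        (∈L-concat-tabulate L values k x∈values)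

    ρ-x-agrees : {G : FSet} (δ : Mor G H) (y : Elt G (⟦_⟧ L T)) (k : Fin (n 𝒞)) →
      let π₁ₖ = π₁ (mor 𝒞 k) ⟨ δ , y ⟩ ; π₂ₖ = π₂ (mor 𝒞 k) ⟨ δ , y ⟩ in
      Loc₂ (Pullback (mor 𝒞 k) ⟨ δ , y ⟩) (restrict π₁ₖ (ρ-x k))
           (extend (restrict π₂ₖ (extend (restrict δ σ) y)) (restrict π₁ₖ (x k))) Agree-with-s
    ρ-x-agrees δ y k = Loc₂-global λ d _ _ →
      agree (λ where
        (here refl)         → fun-cong (x k) refl _ _
        (there (here refl)) → trans (cong proj₂ (glue′ d _ (def₂ d))) (fun-cong y refl _ _)
        (there (there z))   →
          cong (λ e → All.lookup e z)
               (fun-cong ρ (trans (cong proj₁ (glue′ d _ (def₂ d))) (fun-cong δ refl _ _)) _ _))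
      , refl

    ∃∈Φ-forced : (G : FSet) (δ : Mor G H) (y : Elt G (⟦_⟧ L T)) →
      _⊩_[_] L G ∃∈Φ (extend (restrict δ σ) y)
    ∃∈Φ-forced G δ y = Cover-pullback 𝒞 ⟨ δ , y ⟩ , λ k →
      let π₁ₖ = π₁ (mor 𝒞 k) ⟨ δ , y ⟩ ; agrees = ρ-x-agrees δ y k
          x∈values = Loc-restrict (ρ-x k) (head-∈ (values k)) (x-standard k) π₁ₖ
      in restrict π₁ₖ (x k) ,
         lift (Loc-transport x∈values agrees (∈values⇒∈s k)) ,
         ⊩-rename L r Φ (Loc₂-map proj₁ agrees) (⊩-restrict L Φ (ρ-x k) π₁ₖ (x-Φ k))

  NCR-conclusion : (H : FSet) (ρ : Elt H (Env L Γ)) →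
    _⊩_[_] L H (∀f T (∃st L S Φ)) ρ → _⊩_[_] L H (∃st L (S *) (∀f T ∃∈Φ)) ρ
  NCR-conclusion H ρ hyp = idCover H , λ _ → constElt H s , s-standard , ∃∈Φ-forced
    where open GenericInstance H ρ hyp

  NCR-forced : (F : FSet) (ρ : Elt F (Env L Γ)) → _⊩_[_] L F (NCR L S T Φ) ρ
  NCR-forced F ρ H β = NCR-conclusion H (restrict β ρ)

mainTheorem8 : (L : Language) (S T : Ty L) (Γ : Ctx L)
               (Φ : Formula L (S ∷ T ∷ Γ)) →
               Valid L (closeAll L Γ (NCR L S T Φ))
mainTheorem8 L S T Γ Φ = Valid-closeAll L Γ (NCR L S T Φ) (NCR-forced L Φ)
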